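{- Let $I$ be a binary CSP instance and $x_p,x_j,x_i$ variables with $x_p\neq x_j$, $x_j\neq x_i$ and $p\neq i$. If $x_p$ justifies the elimination of $x_j$ by the triangle property in $I$ and $x_j$ justifies the elimination of $x_i$ by the triangle property in $I$, then $x_p$ justifies the elimination of $x_i$ by the triangle property in $I_{ -j}$, the instance obtained from $I$ by eliminating $x_j$.
   Context: A binary CSP instance $I=\langle X,\mathcal{D},R\rangle$ consists of a finite set $X$ of variables, a finite domain $\mathcal{D}(x_i)$ for each variable, and for each ordered pair of distinct variables $(x_i,x_j)$ a relation $R_{ij}\subseteq \mathcal{D}(x_i)\times\mathcal{D}(x_j)$, with $R_{ji}$ the transpose of $R_{ij}$ (absent an explicit constraint, $R_{ij}=\mathcal{D}(x_i)\times\mathcal{D}(x_j)$). Eliminating a variable $x_j$ from $I$ produces the instance $I_{ -j}$ obtained by (1) deleting, for each $q\neq j$, every $v_q\in\mathcal{D}(x_q)$ having no compatible value in $\mathcal{D}(x_j)$, and (2) deleting $x_j$ and all constraints involving $x_j$. For distinct variables $x_i,x_j$ of an instance $I$, $x_j$ justifies the elimination by the triangle property of $x_i$ in $I$ if for every $v_j\in\mathcal{D}(x_j)$ there exists $u_{ji}(v_j)\in\mathcal{D}(x_i)$ such that (C1) $(u_{ji}(v_j),v_j)\in R_{ij}$ and (C2) for all $x_k\in X\setminus\{x_i,x_j\}$ and all $v_k\in\mathcal{D}(x_k)$, $(v_j,v_k)\in R_{jk}$ implies $(u_{ji}(v_j),v_k)\in R_{ik}$ (all domains, relations and variable sets taken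 in the instance under consideration). -}

module Defs where

open import Data.Nat using (ℕ)
open import Data.Fin using (Fin)
open import Data.Product using (Σ; ∃; _×_; _,_)
open import Relation.Binary.PropositionalEquality using (_≡_; _≢_)
open import Function.Bundles using (_⇔_; mk⇔; Equivalence)

-- The variable set X is a subset of Fin n; variable x_i takes values in the
-- finite set Fin (m i), and its domain D(x_i) is a subset of it.
-- rel i j a b  means  (a , b) ∈ R_ij.
record Instance (n : ℕ) (m : Fin n → ℕ) : Set₁ where
  field
    inX   : Fin n → Set
    dom   : (i : Fin n) → Fin (m i) → Set
    rel   : (i j : Fin n) → Fin (m i) → Fin (m j) → Set
    rel-dom   : ∀ i j a b → rel i j a b → dom i a × dom j b
    rel-trans : ∀ i j a b → rel i j a b ⇔ rel j i b a

open Instance public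

eliminate : ∀ {n m} → Instance n m → Fin n → Instance n m
eliminate {n} {m} I j = record
  { inX = λ q → inX I q × q ≢ j
  ; dom = dom'
  ; rel = λ q r a b → dom' q a × dom' r b × rel I q r a b
  ; rel-dom = λ { q r a b (da , db , _) → da , db }
  ; rel-trans = λ q r a b → mk⇔
      (λ { (da , db , x) → db , da , Equivalence.to (rel-trans I q r a b) x })
      (λ { (db , da , x) → da , db , Equivalence.from (rel-trans I q r a b) x })
  }
  where
  dom' : (q : Fin n) → Fin (m q) → Set
  dom' q v = dom I q v × ∃ λ w → dom I j w × rel I q j v w

-- "x_j justifies the elimination by the triangle property of x_i in I"
-- (x_i, x_j distinct variables of I are hypotheses of the lemma).
TriangleJustifies : ∀ {n m} → Instance n m → (i j : Fin n) → Set
TriangleJustifies {n} {m} I i j =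
  (vj : Fin (m j)) → dom I j vj →
    Σ (Fin (m i)) λ u →
      dom I i u
      × rel I i j u vj
      × ((k : Fin n) → inX I k → k ≢ i → k ≢ j →
           (vk : Fin (m k)) → dom I k vk →
           rel I j k vj vk → rel I i k u vk)

-- The witness for x_i is the composite u_ji(u_pj(v_p)): for v_p ∈ D(x_p), take
-- w = u_pj(v_p) ∈ D(x_j) and u = u_ji(w) ∈ D(x_i). Since (u, w) ∈ R_ij, u survives
-- the elimination of x_j; and any support (v_p, v_k) is transported first to
-- (w, v_k) and then to (u, v_k), which is possible for k ∉ {i, j, p}.
module Submission where

open import Defs
open import Data.Nat using (ℕ)
open import Data.Fin using (Fin)
open import Data.Product using (_,_)
open import Relation.Binary.PropositionalEquality using (_≢_)

module _ {n : ℕ} {m : Fin n → ℕ} (I : Instance n m) where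

  dom-eliminate : ∀ {j q v w} → dom I q v → dom I j w → rel I q j v w →
                  dom (eliminate I j) q v
  dom-eliminate dv dw r = dv , _ , dw , r

  rel-eliminate : ∀ {j q r a b} →
                  dom (eliminate I j) q a → dom (eliminate I j) r b → rel I q r a b →
                  rel (eliminate I j) q r a b
  rel-eliminate da db r = da , db , r

lemma1 : {n : ℕ} {m : Fin n → ℕ} (I : Instance n m) (p j i : Fin n) →
    inX I p → inX I j → inX I i →
    p ≢ j → j ≢ i → p ≢ i →
    TriangleJustifies I j p →
    TriangleJustifies I i j →
    TriangleJustifies (eliminate I j) i p
lemma1 {n} {m} I p j i xp _ _ p≢j _ p≢i pj ji vp dvp′@(dvp , _)
  with pj vp dvp
... | w , dw , w~vp , transport-pj
  with ji w dw
... | u , du , u~w , transport-ji =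
  u , du′ , rel-eliminate I du′ dvp′ u~vp , transport
  where
  I₋ⱼ : Instance n m
  I₋ⱼ = eliminate I j

  du′ : dom I₋ⱼ i u
  du′ = dom-eliminate I du dw u~w

  u~vp : rel I i p u vp
  u~vp = transport-ji p xp p≢i p≢j vp dvp w~vp

  transport : (k : Fin n) → inX I₋ⱼ k → k ≢ i → k ≢ p →
              (vk : Fin (m k)) → dom I₋ⱼ k vk → rel I₋ⱼ p k vp vk → rel I₋ⱼ i k u vk
  transport k (xk , k≢j) k≢i k≢p vk dvk′@(dvk , _) (_ , _ , vp~vk) =
    rel-eliminate I du′ dvk′
      (transport-ji k xk k≢i k≢j vk dvk (transport-pj k xk k≢j k≢p vk dvk vp~vk))
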